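{- Let $G=(V,E)$ be a simple undirected graph, let $S\subseteq\binom{V}{2}$ be a set of terminal pairs, let $a^{\mathsf T}x\geq b$ define a shared facet of $\mathrm{MultC}(G,S)$, let $v,w\in V$ with $e^*=vw\notin E$, and let $\overline G=(V,E\cup\{e^*\})$. Assume there is an $S$-multicut $\delta^*$ in $\overline G$ such that $e^*\notin\delta^*$ and $\sum_{e\in E}a_ex^{\delta^*}_e=b$. Then $\sum_{e\in E}a_ex_e\geq b$ defines a shared facet of $\mathrm{MultC}(\overline G,S)$.
   Context: Given a graph $G=(V,E)$ and $S\subseteq\binom{V}{2}$, an ($S$-)multicut is a set $\delta\subseteq E$ such that for every $\{s,t\}\in S$ the nodes $s$ and $t$ lie in different components of $G-\delta$. For $F\subseteq E$, $x^F\in\mathbb{R}^E$ is its incidence vector. The multicut polytope is $\mathrm{MultC}^{\square}(G,S)=\mathrm{conv}\{x^\delta:\delta\text{ an } S\text{ -multicut}\}$ and the multicut dominant is $\mathrm{MultC}(G,S)=\mathrm{MultC}^{\square}(G,S)+\mathbb{R}^E_{\geq 0}$. A facet-defining inequality of $\mathrm{MultC}(G,S)$ defines a shared facet if it is also facet-defining for $\mathrm{MultC}^{\square}(G,S)$.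
   Formalization: The coefficients $a$ and $b$ are rational rather than real, and the points of $\mathrm{MultC}(G,S)$ and $\mathrm{MultC}^{\square}(G,S)$, for both G and Ḡ, have rational coordinates. -}

module Defs where

open import Data.Nat using (ℕ; zero; suc)
open import Data.Fin using (Fin; zero; suc)
open import Data.Bool using (Bool; true; false; if_then_else_)
open import Data.Product using (Σ; ∃; _×_; _,_)
open import Data.Sum using (_⊎_)
open import Data.Rational using (ℚ; 0ℚ; 1ℚ; _+_; _*_; _≤_)
open import Relation.Binary.PropositionalEquality using (_≡_; _≢_)
open import Relation.Nullary using (¬_)

-- Vertices: Fin n.  A graph with m edges is given by its endpoint map
-- ends : Fin m → Fin n × Fin n (edge e joins the two endpoints).
-- Points of ℝ^E are modelled as rational vectors Fin m → ℚ.

Vec : ℕ → Set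
Vec m = Fin m → ℚ

sumF : ∀ {k} → (Fin k → ℚ) → ℚ
sumF {zero}  f = 0ℚ
sumF {suc k} f = f zero + sumF (λ i → f (suc i))

dot : ∀ {m} → Vec m → Vec m → ℚ
dot a x = sumF (λ e → a e * x e)

SimpleGraph : ∀ {n m} → (Fin m → Fin n × Fin n) → Set
SimpleGraph {n} {m} ends =
  (∀ e → let (u , v) = ends e in u ≢ v) ×
  (∀ e f → let (u , v) = ends e in let (u' , v') = ends f in
     ((u ≡ u' × v ≡ v') ⊎ (u ≡ v' × v ≡ u')) → e ≡ f)

Joins : ∀ {n m} → (Fin m → Fin n × Fin n) → Fin m → Fin n → Fin n → Set
Joins ends e u u' = ends e ≡ (u , u') ⊎ ends e ≡ (u' , u)

-- Reach ends δ s t : t is reachable from s in G - δ  (δ e ≡ true means e ∈ δ)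
data Reach {n m} (ends : Fin m → Fin n × Fin n) (δ : Fin m → Bool)
     : Fin n → Fin n → Set where
  here : ∀ {s} → Reach ends δ s s
  step : ∀ {u u' t} (e : Fin m) → δ e ≡ false → Joins ends e u u' →
         Reach ends δ u' t → Reach ends δ u t

IsMulticut : ∀ {n m} → (Fin m → Fin n × Fin n) → (Fin n → Fin n → Set) →
             (Fin m → Bool) → Set
IsMulticut ends S δ = ∀ s t → S s t → ¬ Reach ends δ s t

incid : ∀ {m} → (Fin m → Bool) → Vec m
incid δ e = if δ e then 1ℚ else 0ℚ

-- MultC^□(G,S) : convex hull of incidence vectors of S-multicuts
InMultCPoly : ∀ {n m} → (Fin m → Fin n × Fin n) → (Fin n → Fin n → Set) →
              Vec m → Set
InMultCPoly {n} {m} ends S y =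
  Σ ℕ λ k → Σ (Fin k → ℚ) λ lam → Σ (Fin k → (Fin m → Bool)) λ δs →
    (∀ i → 0ℚ ≤ lam i) × (sumF lam ≡ 1ℚ) ×
    (∀ i → IsMulticut ends S (δs i)) ×
    (∀ e → y e ≡ sumF (λ i → lam i * incid (δs i) e))

-- MultC(G,S) = MultC^□(G,S) + ℝ^E_{≥0}
InMultCDom : ∀ {n m} → (Fin m → Fin n × Fin n) → (Fin n → Fin n → Set) →
             Vec m → Set
InMultCDom {n} {m} ends S y =
  Σ (Vec m) λ z → InMultCPoly ends S z × (∀ e → z e ≤ y e)

AffIndep : ∀ {m r} → (Fin r → Vec m) → Set
AffIndep {m} {r} p = ∀ (lam : Fin r → ℚ) → sumF lam ≡ 0ℚ →
  (∀ e → sumF (λ i → lam i * p i e) ≡ 0ℚ) → ∀ i → lam i ≡ 0ℚ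

-- AffRank P r : the maximum number of affinely independent points of P is r
-- (i.e. dim P = r - 1)
AffRank : ∀ {m} → (Vec m → Set) → ℕ → Set
AffRank {m} P r =
  (Σ (Fin r → Vec m) λ p → (∀ i → P (p i)) × AffIndep p) ×
  (∀ (p : Fin (suc r) → Vec m) → (∀ i → P (p i)) → ¬ AffIndep p)

FacetDefining : ∀ {m} → (Vec m → Set) → Vec m → ℚ → Set
FacetDefining {m} P a b =
  (∀ y → P y → b ≤ dot a y) ×
  Σ ℕ λ k → AffRank (λ y → P y × dot a y ≡ b) (suc k) × AffRank P (suc (suc k))

SharedFacet : ∀ {n m} → (Fin m → Fin n × Fin n) → (Fin n → Fin n → Set) →
              Vec m → ℚ → Set
SharedFacet ends S a b =
  FacetDefining (InMultCDom ends S) a b × FacetDefining (InMultCPoly ends S) a b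

-- Ḡ = (V, E ∪ {e*}) with e* = vw as edge index zero
addEdge : ∀ {n m} → (Fin m → Fin n × Fin n) → Fin n → Fin n →
          Fin (suc m) → Fin n × Fin n
addEdge ends v w zero    = (v , w)
addEdge ends v w (suc e) = ends e

-- extend a by coefficient 0 on e*  (the inequality Σ_{e∈E} a_e x_e ≥ b on ℝ^{E∪{e*}})
extend0 : ∀ {m} → Vec m → Vec (suc m)
extend0 a zero    = 0ℚ
extend0 a (suc e) = a e

-- The new edge e* only enlarges the ambient space by one coordinate.  Deleting
-- that coordinate maps MultC(Ḡ,S) and MultC□(Ḡ,S) into their counterparts for
-- G, and setting it to 1 (cutting e* as well) maps them back, so the
-- inequality stays valid.  Lifting affinely independent points p_i to (1, p_i)
-- and adding x^δ*, whose e*-coordinate is 0, raises the affine rank of the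
-- polyhedron and of the face by one; deleting a coordinate lowers affine rank
-- by at most one, so both ranks grow by exactly one and the face is still a
-- facet.
module Submission where

open import Defs
open import Data.Nat using (ℕ; suc)
open import Data.Fin using (Fin; zero; suc; punchIn)
open import Data.Bool using (Bool; true; false; if_then_else_)
open import Data.Product using (_×_; _,_; uncurry)
open import Data.Rational using (ℚ; 0ℚ; 1ℚ; _+_; _*_; -_; _≤_; _≟_; 1/_; ≢-nonZero)
open import Data.Rational.Properties
  using (+-*-ring; +-0-commutativeMonoid; +-identityˡ; +-identityʳ; *-identityˡ; *-identityʳ;
         *-zeroˡ; *-zeroʳ; *-comm; *-assoc; *-inverseˡ; ≤-refl; nonNegative⁻¹)
open import Data.Rational.Solver using (module +-*-Solver)
open import Data.Vec.Functional using (_∷_; tail; map; removeAt; insertAt)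
open import Data.Vec.Functional.Properties using (insertAt-lookup; insertAt-punchIn)
open import Algebra.Bundles using (Ring)
open import Algebra.Properties.Semiring.Sum (Ring.semiring +-*-ring)
  using (sum; sum-cong-≗; *-distribˡ-sum)
open import Algebra.Properties.CommutativeMonoid.Sum +-0-commutativeMonoid
  using (sum-remove; ∑-distrib-+)
open import Data.Empty using (⊥-elim)
open import Function using (_∘_)
open import Relation.Nullary using (¬_; yes; no)
open import Relation.Binary.PropositionalEquality
  using (_≡_; _≢_; refl; sym; trans; cong; cong₂; subst; module ≡-Reasoning)

open +-*-Solver
open ≡-Reasoning

sumF≡sum : ∀ {k} (f : Fin k → ℚ) → sumF f ≡ sum f
sumF≡sum {ℕ.zero} f = refl
sumF≡sum {suc k}  f = cong (f zero +_) (sumF≡sum (tail f))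

sumF-cong : ∀ {k} {f g : Fin k → ℚ} → (∀ i → f i ≡ g i) → sumF f ≡ sumF g
sumF-cong {f = f} {g} f≗g =
  trans (sumF≡sum f) (trans (sum-cong-≗ f≗g) (sym (sumF≡sum g)))

sumF-linear : ∀ {k} (c d : ℚ) (f g : Fin k → ℚ) →
  sumF (λ i → c * f i + d * g i) ≡ c * sumF f + d * sumF g
sumF-linear c d f g = begin
  sumF (λ i → c * f i + d * g i)           ≡⟨ sumF≡sum (λ i → c * f i + d * g i) ⟩
  sum (λ i → c * f i + d * g i)            ≡⟨ ∑-distrib-+ (map (c *_) f) (map (d *_) g) ⟩
  sum (map (c *_) f) + sum (map (d *_) g)  ≡⟨ sym (cong₂ _+_ (*-distribˡ-sum c f) (*-distribˡ-sum d g)) ⟩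
  c * sum f + d * sum g                    ≡⟨ sym (cong₂ (λ s t → c * s + d * t) (sumF≡sum f) (sumF≡sum g)) ⟩
  c * sumF f + d * sumF g                  ∎

sumF-removeAt : ∀ {k} (f : Fin (suc k) → ℚ) (j : Fin (suc k)) →
  f j ≡ 0ℚ → sumF f ≡ sumF (removeAt f j)
sumF-removeAt f j fj≡0 = begin
  sumF f                          ≡⟨ sumF≡sum f ⟩
  sum f                           ≡⟨ sum-remove f ⟩
  f j + sum (removeAt f j)        ≡⟨ cong₂ _+_ fj≡0 (sym (sumF≡sum (removeAt f j))) ⟩
  0ℚ + sumF (removeAt f j)        ≡⟨ +-identityˡ (sumF (removeAt f j)) ⟩
  sumF (removeAt f j)             ∎

p≢0∧p*q≡0⇒q≡0 : ∀ {p q} → p ≢ 0ℚ → p * q ≡ 0ℚ → q ≡ 0ℚ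
p≢0∧p*q≡0⇒q≡0 {p} {q} p≢0 pq≡0 = begin
  q                ≡⟨ sym (*-identityˡ q) ⟩
  1ℚ * q           ≡⟨ cong (_* q) (sym (*-inverseˡ p)) ⟩
  (1/ p * p) * q   ≡⟨ *-assoc (1/ p) p q ⟩
  1/ p * (p * q)   ≡⟨ cong (1/ p *_) pq≡0 ⟩
  1/ p * 0ℚ        ≡⟨ *-zeroʳ (1/ p) ⟩
  0ℚ               ∎
  where instance _ = ≢-nonZero p≢0

AffDep : ∀ {m r} → (Fin r → Vec m) → (Fin r → ℚ) → Set
AffDep p lam = sumF lam ≡ 0ℚ × (∀ e → sumF (λ i → lam i * p i e) ≡ 0ℚ)

insertAt-affDep : ∀ {m r} (p : Fin (suc r) → Vec m) (j : Fin (suc r)) (ν : Fin r → ℚ) →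
  AffDep (removeAt p j) ν → AffDep p (insertAt ν j 0ℚ)
insertAt-affDep p j ν (sum≡0 , dep) =
  trans (sumF-removeAt N j (insertAt-lookup ν j 0ℚ)) (trans (sumF-cong (insertAt-punchIn ν j 0ℚ)) sum≡0) ,
  λ e → trans (sumF-removeAt (λ k → N k * p k e) j (Nj*pje≡0 e))
              (trans (sumF-cong (λ i → cong (_* p (punchIn j i) e) (insertAt-punchIn ν j 0ℚ i))) (dep e))
  where
  N : Fin (suc _) → ℚ
  N = insertAt ν j 0ℚ
  Nj*pje≡0 : ∀ e → N j * p j e ≡ 0ℚ
  Nj*pje≡0 e = trans (cong (_* p j e) (insertAt-lookup ν j 0ℚ)) (*-zeroˡ (p j e))

affIndep-∷ : ∀ {m r} (q : Vec (suc m)) (p : Fin r → Vec m) → q zero ≡ 0ℚ →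
  AffIndep p → AffIndep (q ∷ map (1ℚ ∷_) p)
affIndep-∷ {m} q p q₀≡0 ind lam sum≡0 dep = lam≡0
  where
  L : Fin _ → Vec (suc m)
  L = q ∷ map (1ℚ ∷_) p

  tail-sum≡0 : sumF (tail lam) ≡ 0ℚ
  tail-sum≡0 = begin
    sumF (tail lam)                                     ≡⟨ sumF-cong (λ i → sym (*-identityʳ (lam (suc i)))) ⟩
    sumF (λ i → lam (suc i) * 1ℚ)                       ≡⟨ sym (sumF-removeAt (λ k → lam k * L k zero) zero lam₀q₀≡0) ⟩
    sumF (λ k → lam k * L k zero)                       ≡⟨ dep zero ⟩
    0ℚ                                                  ∎
    where
    lam₀q₀≡0 : lam zero * q zero ≡ 0ℚ
    lam₀q₀≡0 = trans (cong (lam zero *_) q₀≡0) (*-zeroʳ (lam zero))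

  lam₀≡0 : lam zero ≡ 0ℚ
  lam₀≡0 = begin
    lam zero                    ≡⟨ sym (+-identityʳ (lam zero)) ⟩
    lam zero + 0ℚ               ≡⟨ cong (lam zero +_) (sym tail-sum≡0) ⟩
    lam zero + sumF (tail lam)  ≡⟨ sum≡0 ⟩
    0ℚ                          ∎

  tail-dep : ∀ e → sumF (λ i → lam (suc i) * p i e) ≡ 0ℚ
  tail-dep e = trans (sym (sumF-removeAt (λ k → lam k * L k (suc e)) zero lam₀qₑ≡0)) (dep (suc e))
    where
    lam₀qₑ≡0 : lam zero * q (suc e) ≡ 0ℚ
    lam₀qₑ≡0 = trans (cong (_* q (suc e)) lam₀≡0) (*-zeroˡ (q (suc e)))

  lam≡0 : ∀ k → lam k ≡ 0ℚ
  lam≡0 zero    = lam₀≡0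
  lam≡0 (suc i) = ind (tail lam) tail-sum≡0 tail-dep i

height : ∀ {m r} → (Fin r → Vec (suc m)) → (Fin r → ℚ) → ℚ
height p μ = sumF (λ k → μ k * p k zero)

-- The coefficients are chosen so that the head coordinates cancel.
tails-affDep-eliminate : ∀ {m r} (p : Fin r → Vec (suc m)) (Λ N : Fin r → ℚ) →
  AffDep (map tail p) Λ → AffDep (map tail p) N →
  AffDep p (λ k → height p Λ * N k + (- height p N) * Λ k)
tails-affDep-eliminate p Λ N (sumΛ≡0 , depΛ) (sumN≡0 , depN) = M-sum , M-dep
  where
  c d : ℚ
  c = height p Λ
  d = - height p N

  c*0+d*0≡0 : c * 0ℚ + d * 0ℚ ≡ 0ℚ
  c*0+d*0≡0 = solve 2 (λ c d → c :* con 0ℚ :+ d :* con 0ℚ := con 0ℚ) refl c d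

  M-weighted : ∀ x → sumF (λ k → (c * N k + d * Λ k) * x k) ≡
    c * sumF (λ k → N k * x k) + d * sumF (λ k → Λ k * x k)
  M-weighted x = trans (sumF-cong (λ k → distrib (N k) (Λ k) (x k)))
                       (sumF-linear c d (λ k → N k * x k) (λ k → Λ k * x k))
    where
    distrib : ∀ a b y → (c * a + d * b) * y ≡ c * (a * y) + d * (b * y)
    distrib = solve 5 (λ c d a b y → (c :* a :+ d :* b) :* y := c :* (a :* y) :+ d :* (b :* y)) refl c d

  M-sum : sumF (λ k → c * N k + d * Λ k) ≡ 0ℚ
  M-sum = trans (sumF-linear c d N Λ)
                (trans (cong₂ (λ s t → c * s + d * t) sumN≡0 sumΛ≡0) c*0+d*0≡0)

  M-dep : ∀ e → sumF (λ k → (c * N k + d * Λ k) * p k e) ≡ 0ℚ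
  M-dep zero    = trans (M-weighted (λ k → p k zero))
    (solve 2 (λ c h → c :* h :+ (:- h) :* c := con 0ℚ) refl c (height p N))
  M-dep (suc e) = trans (M-weighted (λ k → p k (suc e)))
    (trans (cong₂ (λ s t → c * s + d * t) (depN e) (depΛ e)) c*0+d*0≡0)

removeAt-tails-affIndep : ∀ {m r} (p : Fin (suc r) → Vec (suc m)) → AffIndep p →
  (Λ : Fin (suc r) → ℚ) → AffDep (map tail p) Λ → (j : Fin (suc r)) → Λ j ≢ 0ℚ →
  AffIndep (removeAt (map tail p) j)
removeAt-tails-affIndep {r = r} p ind Λ Λ-dep@(sumΛ≡0 , depΛ) j Λj≢0 ν sumν≡0 depν i =
  p≢0∧p*q≡0⇒q≡0 c≢0 cνᵢ≡0
  where
  N : Fin (suc r) → ℚ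
  N = insertAt ν j 0ℚ

  c d : ℚ
  c = height p Λ
  d = - height p N

  c≢0 : c ≢ 0ℚ
  c≢0 c≡0 = Λj≢0 (ind Λ sumΛ≡0 (λ { zero → c≡0 ; (suc e) → depΛ e }) j)

  M≡0 : ∀ k → c * N k + d * Λ k ≡ 0ℚ
  M≡0 = uncurry (ind (λ k → c * N k + d * Λ k))
          (tails-affDep-eliminate p Λ N Λ-dep (insertAt-affDep (map tail p) j ν (sumν≡0 , depν)))

  d≡0 : d ≡ 0ℚ
  d≡0 = p≢0∧p*q≡0⇒q≡0 Λj≢0 (begin
    Λ j * d              ≡⟨ *-comm (Λ j) d ⟩
    d * Λ j              ≡⟨ sym (+-identityˡ (d * Λ j)) ⟩
    0ℚ + d * Λ j         ≡⟨ cong (_+ d * Λ j) (sym (trans (cong (c *_) (insertAt-lookup ν j 0ℚ)) (*-zeroʳ c))) ⟩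
    c * N j + d * Λ j    ≡⟨ M≡0 j ⟩
    0ℚ                   ∎)

  cνᵢ≡0 : c * ν i ≡ 0ℚ
  cνᵢ≡0 = begin
    c * ν i              ≡⟨ sym (+-identityʳ (c * ν i)) ⟩
    c * ν i + 0ℚ         ≡⟨ cong (c * ν i +_) (sym (*-zeroˡ (Λ k))) ⟩
    c * ν i + 0ℚ * Λ k   ≡⟨ sym (cong₂ (λ s t → c * s + t * Λ k) (insertAt-punchIn ν j 0ℚ i) d≡0) ⟩
    c * N k + d * Λ k    ≡⟨ M≡0 k ⟩
    0ℚ                   ∎
    where
    k : Fin (suc r)
    k = punchIn j i

-- Deleting a coordinate drops affine rank by at most one: either the tails
-- without p₀ are independent, or some dependency among them has a nonzero
-- coefficient at i, and then the tails without pᵢ are.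
affIndep⇒¬∀removeAt-tails-¬affIndep : ∀ {m r} (p : Fin (suc (suc r)) → Vec (suc m)) →
  AffIndep p → ¬ (∀ j → ¬ AffIndep (removeAt (map tail p) j))
affIndep⇒¬∀removeAt-tails-¬affIndep p ind none = none zero indep₀
  where
  indep₀ : AffIndep (removeAt (map tail p) zero)
  indep₀ lam sum≡0 dep i with lam i ≟ 0ℚ
  ... | yes lamᵢ≡0 = lamᵢ≡0
  ... | no  lamᵢ≢0 = ⊥-elim (none (suc i)
    (removeAt-tails-affIndep p ind (insertAt lam zero 0ℚ)
      (insertAt-affDep (map tail p) zero lam (sum≡0 , dep)) (suc i) lamᵢ≢0))

affRank-lift : ∀ {m r} (P : Vec m → Set) (Q : Vec (suc m) → Set) →
  (∀ y → Q y → P (tail y)) → (∀ y → P y → Q (1ℚ ∷ y)) →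
  (q : Vec (suc m)) → Q q → q zero ≡ 0ℚ → AffRank P r → AffRank Q (suc r)
affRank-lift P Q Q⇒P-tail P⇒Q-∷ q q∈Q q₀≡0 ((p , p∈P , p-indep) , P-maximal) =
  (q ∷ map (1ℚ ∷_) p , lifted∈Q , affIndep-∷ q p q₀≡0 p-indep) , Q-maximal
  where
  lifted∈Q : ∀ k → Q ((q ∷ map (1ℚ ∷_) p) k)
  lifted∈Q zero    = q∈Q
  lifted∈Q (suc i) = P⇒Q-∷ (p i) (p∈P i)

  Q-maximal : ∀ p′ → (∀ k → Q (p′ k)) → ¬ AffIndep p′
  Q-maximal p′ p′∈Q indep = affIndep⇒¬∀removeAt-tails-¬affIndep p′ indep
    (λ j → P-maximal (removeAt (map tail p′) j) (λ i → Q⇒P-tail _ (p′∈Q (punchIn j i))))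

dot-extend0 : ∀ {m} (a : Vec m) (y : Vec (suc m)) → dot (extend0 a) y ≡ dot a (tail y)
dot-extend0 a y = trans (cong (_+ dot a (tail y)) (*-zeroˡ (y zero))) (+-identityˡ (dot a (tail y)))

facet-lift : ∀ {m} (P : Vec m → Set) (Q : Vec (suc m) → Set) (a : Vec m) (b : ℚ) →
  (∀ y → Q y → P (tail y)) → (∀ y → P y → Q (1ℚ ∷ y)) →
  (q : Vec (suc m)) → Q q → q zero ≡ 0ℚ → dot a (tail q) ≡ b →
  FacetDefining P a b → FacetDefining Q (extend0 a) b
facet-lift P Q a b Q⇒P-tail P⇒Q-∷ q q∈Q q₀≡0 aq≡b (valid , k , rank-face , rank-P) =
  valid′ , suc k ,
  affRank-lift (Face P a) (Face Q (extend0 a)) face-tail face-∷ q (q∈Q , trans (dot-extend0 a q) aq≡b) q₀≡0 rank-face ,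
  affRank-lift P Q Q⇒P-tail P⇒Q-∷ q q∈Q q₀≡0 rank-P
  where
  Face : ∀ {m′} → (Vec m′ → Set) → Vec m′ → Vec m′ → Set
  Face R c y = R y × dot c y ≡ b

  valid′ : ∀ y → Q y → b ≤ dot (extend0 a) y
  valid′ y y∈Q = subst (b ≤_) (sym (dot-extend0 a y)) (valid (tail y) (Q⇒P-tail y y∈Q))

  face-tail : ∀ y → Face Q (extend0 a) y → Face P a (tail y)
  face-tail y (y∈Q , ay≡b) = Q⇒P-tail y y∈Q , trans (sym (dot-extend0 a y)) ay≡b

  face-∷ : ∀ y → Face P a y → Face Q (extend0 a) (1ℚ ∷ y)
  face-∷ y (y∈P , ay≡b) = P⇒Q-∷ y y∈P , trans (dot-extend0 a (1ℚ ∷ y)) ay≡b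

incid-poly : ∀ {n m} (ends : Fin m → Fin n × Fin n) (S : Fin n → Fin n → Set) (δ : Fin m → Bool) →
  IsMulticut ends S δ → InMultCPoly ends S (incid δ)
incid-poly ends S δ δ-cut =
  1 , (λ _ → 1ℚ) , (λ _ → δ) , (λ _ → nonNegative⁻¹ 1ℚ) , +-identityʳ 1ℚ , (λ _ → δ-cut) ,
  (λ e → sym (trans (+-identityʳ (1ℚ * incid δ e)) (*-identityˡ (incid δ e))))

incid-dom : ∀ {n m} (ends : Fin m → Fin n × Fin n) (S : Fin n → Fin n → Set) (δ : Fin m → Bool) →
  IsMulticut ends S δ → InMultCDom ends S (incid δ)
incid-dom ends S δ δ-cut = incid δ , incid-poly ends S δ δ-cut , (λ _ → ≤-refl)

module _ {n m} (ends : Fin m → Fin n × Fin n) (S : Fin n → Fin n → Set) (v w : Fin n) where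

  Reach-addEdge : ∀ {δ s t} → Reach ends (tail δ) s t → Reach (addEdge ends v w) δ s t
  Reach-addEdge here                  = here
  Reach-addEdge (step e δe≡false j r) = step (suc e) δe≡false j (Reach-addEdge r)

  Reach-removeCutEdge : ∀ {δ s t} → Reach (addEdge ends v w) (true ∷ δ) s t → Reach ends δ s t
  Reach-removeCutEdge here                        = here
  Reach-removeCutEdge (step zero    () j r)
  Reach-removeCutEdge (step (suc e) δe≡false j r) = step e δe≡false j (Reach-removeCutEdge r)

  poly-tail : ∀ y → InMultCPoly (addEdge ends v w) S y → InMultCPoly ends S (tail y)
  poly-tail y (k , lam , δs , lam≥0 , sum≡1 , δs-cut , y≡) =
    k , lam , tail ∘ δs , lam≥0 , sum≡1 ,
    (λ i s t st r → δs-cut i s t st (Reach-addEdge r)) , (λ e → y≡ (suc e))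

  poly-∷ : ∀ y → InMultCPoly ends S y → InMultCPoly (addEdge ends v w) S (1ℚ ∷ y)
  poly-∷ y (k , lam , δs , lam≥0 , sum≡1 , δs-cut , y≡) =
    k , lam , (true ∷_) ∘ δs , lam≥0 , sum≡1 ,
    (λ i s t st r → δs-cut i s t st (Reach-removeCutEdge r)) , y≡′
    where
    y≡′ : ∀ e → (1ℚ ∷ y) e ≡ sumF (λ i → lam i * incid (true ∷ δs i) e)
    y≡′ zero    = sym (trans (sumF-cong (λ i → *-identityʳ (lam i))) sum≡1)
    y≡′ (suc e) = y≡ e

  dom-tail : ∀ y → InMultCDom (addEdge ends v w) S y → InMultCDom ends S (tail y)
  dom-tail y (z , z∈poly , z≤y) = tail z , poly-tail z z∈poly , (λ e → z≤y (suc e))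

  dom-∷ : ∀ y → InMultCDom ends S y → InMultCDom (addEdge ends v w) S (1ℚ ∷ y)
  dom-∷ y (z , z∈poly , z≤y) = 1ℚ ∷ z , poly-∷ z z∈poly , z≤y′
    where
    z≤y′ : ∀ e → (1ℚ ∷ z) e ≤ (1ℚ ∷ y) e
    z≤y′ zero    = ≤-refl
    z≤y′ (suc e) = z≤y e

lemma3p9 : ∀ {n m} (ends : Fin m → Fin n × Fin n) → SimpleGraph ends →
    (S : Fin n → Fin n → Set) → (∀ s t → S s t → s ≢ t) →
    (a : Fin m → ℚ) (b : ℚ) → SharedFacet ends S a b →
    (v w : Fin n) → v ≢ w → (∀ e → ends e ≢ (v , w) × ends e ≢ (w , v)) →
    (δ* : Fin (suc m) → Bool) → IsMulticut (addEdge ends v w) S δ* →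
    δ* zero ≡ false → dot a (λ e → incid δ* (suc e)) ≡ b →
    SharedFacet (addEdge ends v w) S (extend0 a) b
lemma3p9 ends _ S _ a b (facet-dom , facet-poly) v w _ _ δ* δ*-cut δ*₀≡false aδ*≡b =
  facet-lift (InMultCDom ends S) (InMultCDom Ḡ S) a b (dom-tail ends S v w) (dom-∷ ends S v w)
    (incid δ*) (incid-dom Ḡ S δ* δ*-cut) x*₀≡0 aδ*≡b facet-dom ,
  facet-lift (InMultCPoly ends S) (InMultCPoly Ḡ S) a b (poly-tail ends S v w) (poly-∷ ends S v w)
    (incid δ*) (incid-poly Ḡ S δ* δ*-cut) x*₀≡0 aδ*≡b facet-poly
  where
  Ḡ : Fin (suc _) → Fin _ × Fin _
  Ḡ = addEdge ends v w

  x*₀≡0 : incid δ* zero ≡ 0ℚ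
  x*₀≡0 = cong (λ x → if x then 1ℚ else 0ℚ) δ*₀≡false
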